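{- Let $r \ge 2$ be an integer. If $G$ is a connected $r$-regular graph, then \[ \gamma_c(G) \ge \frac{2\mu(G) - 2}{r-1} \ge \frac{2\alpha(G) - 2}{r-1}. \]
   Context: All graphs are finite, simple and undirected. $\gamma_c(G)$ is the minimum cardinality of a connected dominating set of $G$ (a set $S$ such that every vertex outside $S$ has a neighbor in $S$ and $G[S]$ is connected). $\mu(G)$ is the maximum cardinality of a matching of $G$, and $\alpha(G)$ is the independence number of $G$. -}

module Defs where

open import Data.Nat using (ℕ; _≤_)
open import Data.Bool using (Bool; true; false)
open import Data.Fin using (Fin)
open import Data.Fin.Subset using (Subset; _∈_; _∉_; ∣_∣; ⊤)
open import Data.Vec using (tabulate)
open import Data.List using (List; length; concatMap; _∷_; [])
open import Data.List.Relation.Unary.All using (All)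
open import Data.List.Relation.Unary.Unique.Propositional using (Unique)
open import Data.Product using (_×_; _,_; Σ; ∃; ∃-syntax)
open import Data.Sum using (_⊎_)
open import Relation.Binary.PropositionalEquality using (_≡_)

record Graph (n : ℕ) : Set where
  field
    Adj     : Fin n → Fin n → Bool
    symAdj  : ∀ u v → Adj u v ≡ Adj v u
    irrefl  : ∀ v → Adj v v ≡ false
open Graph public

module _ {n : ℕ} (G : Graph n) where

  Nbhd : Fin n → Subset n
  Nbhd v = tabulate (Adj G v)

  degree : Fin n → ℕ
  degree v = ∣ Nbhd v ∣

  Regular : ℕ → Set
  Regular r = ∀ v → degree v ≡ r

  data WalkIn (S : Subset n) : Fin n → Fin n → Set where
    here : ∀ {u} → u ∈ S → WalkIn S u u
    step : ∀ {u v w} → u ∈ S → Adj G u v ≡ true → WalkIn S v w → WalkIn S u w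

  ConnectedSet : Subset n → Set
  ConnectedSet S = ∀ u v → u ∈ S → v ∈ S → WalkIn S u v

  Connected : Set
  Connected = ConnectedSet ⊤

  Dominating : Subset n → Set
  Dominating S = ∀ v → v ∉ S → ∃[ u ] (u ∈ S × Adj G u v ≡ true)

  ConnDominating : Subset n → Set
  ConnDominating S = Dominating S × ConnectedSet S

  IsConnDomNumber : ℕ → Set
  IsConnDomNumber k =
    (∃[ S ] (ConnDominating S × ∣ S ∣ ≡ k)) × (∀ S → ConnDominating S → k ≤ ∣ S ∣)

  endpoints : List (Fin n × Fin n) → List (Fin n)
  endpoints = concatMap (λ { (u , v) → u ∷ v ∷ [] })

  IsMatching : List (Fin n × Fin n) → Set
  IsMatching M = All (λ { (u , v) → Adj G u v ≡ true }) M × Unique (endpoints M)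

  IsMatchingNumber : ℕ → Set
  IsMatchingNumber m =
    (∃[ M ] (IsMatching M × length M ≡ m)) × (∀ M → IsMatching M → length M ≤ m)

  Independent : Subset n → Set
  Independent S = ∀ u v → u ∈ S → v ∈ S → Adj G u v ≡ false

  IsIndepNumber : ℕ → Set
  IsIndepNumber a =
    (∃[ S ] (Independent S × ∣ S ∣ ≡ a)) × (∀ S → Independent S → ∣ S ∣ ≤ a)

-- A connected dominating set S can be grown from one of its vertices along a spanning tree
-- of G[S]. The closed neighbourhood of the first vertex has r + 1 vertices, and each further
-- tree vertex adds at most r - 1 new ones, since it and its tree parent are already counted.
-- As S dominates G, n ≤ (r - 1)|S| + 2, while trivially 2μ ≤ n.
--
-- For α ≤ μ, every independent set I of an r-regular graph (r ≥ 1) is matched into its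
-- complement by repeated augmentation. If a depth-first search for an augmenting path from an
-- unmatched x ∈ I fails, then x and the mates of the visited vertices V are |V| + 1 vertices
-- whose neighbours all lie in V, which double counting of the edges into V rules out.

module Submission where

open import Defs
open import Data.Bool using (Bool; true; false)
open import Data.Fin using (Fin; zero; suc; _≟_)
open import Data.Fin.Properties using (any?; suc-injective; injective⇒≤)
open import Data.Fin.Subset using (Subset; _∈_; _∉_; _⊆_; ∣_∣; ⊤; ⊥; ⁅_⁆; _∪_; _-_; inside; outside)
open import Data.Fin.Subset.Properties
  using (_∈?_; p⊆p∪q; q⊆p∪q; x∈p∪q⁻; x∈⁅x⁆; x∈⁅y⁆⇒x≡y; x∈p∧x≢y⇒x∈p-y; ∣p∣≤∣x∷p∣; x∈p⇒∣p-x∣<∣p∣;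
         p⊂q⇒∣p∣<∣q∣; p⊆q⇒∣p∣≤∣q∣; ⊆-antisym; ∣p∣≤n; ∣p∣≡n⇒p≡⊤; ∣⊤∣≡n; ∣⁅x⁆∣≡1; ∈⊤; ∉⊥)
open import Data.List using (List; []; _∷_; length; allFin)
import Data.List as List
open import Data.List.Membership.Propositional using () renaming (_∈_ to _∈ˡ_)
open import Data.List.Membership.Propositional.Properties using (∈-allFin; ∈-lookup)
open import Data.List.Relation.Unary.All as All using (All; []; _∷_)
open import Data.List.Relation.Unary.AllPairs using ([]; _∷_)
open import Data.List.Relation.Unary.Any using (here; there)
open import Data.List.Relation.Unary.Unique.Propositional using (Unique)
open import Data.List.Relation.Unary.Unique.Propositional.Properties using (allFin⁺)
open import Data.Maybe using (Maybe; just; nothing; is-just)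
import Data.Maybe.Properties as Maybe
open import Data.Nat using (ℕ; zero; suc; _+_; _*_; _∸_; _≤_; _<_; z≤n; s≤s)
open import Data.Nat.Properties hiding (_≟_; suc-injective)
open import Data.Nat.Solver using (module +-*-Solver)
open import Data.Product using (∃-syntax; _×_; _,_; proj₁; proj₂)
open import Data.Sum using (_⊎_; inj₁; inj₂)
import Data.Sum as Sum
open import Data.Vec using ([]; _∷_; lookup)
open import Data.Vec.Properties using (lookup∘tabulate; []=⇒lookup; lookup⇒[]=)
open import Data.Vec.Functional using (updateAt)
open import Data.Vec.Functional.Properties using (updateAt-updates; updateAt-minimal)
open import Function using (_∘_; const; id)
open import Relation.Nullary using (¬_; yes; no; does; ¬?; _×-dec_; contradiction)
open import Relation.Nullary.Decidable using (dec-true)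
open import Relation.Binary.PropositionalEquality

open import Algebra.Properties.Semiring.Sum +-*-semiring
  using (sum; sum-syntax; sum-cong-≗; ∑-distrib-+; ∑-comm; *-distribˡ-sum; sum-replicate-zero)
open +-*-Solver using (solve; _:+_; _:*_; _:=_; con)

-- Finite sums and cardinalities

⟦_⟧ : Bool → ℕ
⟦ true ⟧ = 1
⟦ false ⟧ = 0

⟦⟧≤1 : ∀ b → ⟦ b ⟧ ≤ 1
⟦⟧≤1 true = ≤-refl
⟦⟧≤1 false = z≤n

δ : ∀ {n} → Fin n → Fin n → ℕ
δ a b = ⟦ does (a ≟ b) ⟧

∑-mono-≤ : ∀ {n} {f g : Fin n → ℕ} → (∀ i → f i ≤ g i) → sum f ≤ sum g
∑-mono-≤ {zero} f≤g = z≤n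
∑-mono-≤ {suc n} f≤g = +-mono-≤ (f≤g zero) (∑-mono-≤ (f≤g ∘ suc))

∑-δ : ∀ {n} (a : Fin n) → ∑[ i < n ] δ a i ≡ 1
∑-δ {suc n} zero = cong suc (sum-replicate-zero n)
∑-δ {suc n} (suc a) = ∑-δ a

∑-≥ : ∀ {n} (f : Fin n → ℕ) i → f i ≤ sum f
∑-≥ f zero = m≤m+n _ _
∑-≥ f (suc i) = ≤-trans (∑-≥ (f ∘ suc) i) (m≤n+m _ (f zero))

∑<∑⇒< : ∀ {n} (f g : Fin n → ℕ) → sum f < sum g → ∃[ i ] f i < g i
∑<∑⇒< {zero} f g ()
∑<∑⇒< {suc n} f g f<g with f zero <? g zero
... | yes f₀<g₀ = zero , f₀<g₀
... | no f₀≮g₀ =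
  let (i , fᵢ<gᵢ) = ∑<∑⇒< (f ∘ suc) (g ∘ suc)
                      (+-cancelˡ-< (g zero) _ _ (≤-<-trans (+-monoˡ-≤ _ (≮⇒≥ f₀≮g₀)) f<g))
  in suc i , fᵢ<gᵢ

∑-positive : ∀ {n} (f : Fin n → ℕ) → 0 < sum f → ∃[ i ] 0 < f i
∑-positive {n} f = ∑<∑⇒< (const 0) f ∘ subst (_< sum f) (sym (sum-replicate-zero n))

∑≤1 : ∀ {n} (f : Fin n → ℕ) → (∀ i → f i ≤ 1) → (∀ {i j} → 0 < f i → 0 < f j → i ≡ j) →
  sum f ≤ 1
∑≤1 {zero} f _ _ = z≤n
∑≤1 {suc n} f f≤1 single with f zero in f₀
... | zero = ∑≤1 (f ∘ suc) (f≤1 ∘ suc) (λ p q → suc-injective (single p q))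
... | suc k = subst (_≤ 1) sum≡f₀ (f≤1 zero)
  where
  rest≤0 : ∀ i → f (suc i) ≤ 0
  rest≤0 i with f (suc i) in fᵢ
  ... | zero = z≤n
  ... | suc _ with () ← single (subst (0 <_) (sym f₀) (s≤s z≤n)) (subst (0 <_) (sym fᵢ) (s≤s z≤n))
  rest≡0 : sum (f ∘ suc) ≡ 0
  rest≡0 = n≤0⇒n≡0 (≤-trans (∑-mono-≤ rest≤0) (≤-reflexive (sum-replicate-zero n)))
  sum≡f₀ : f zero ≡ suc k + sum (f ∘ suc)
  sum≡f₀ = trans f₀ (trans (sym (+-identityʳ (suc k))) (cong (suc k +_) (sym rest≡0)))

∣p∣≡∑ : ∀ {n} (p : Subset n) → ∣ p ∣ ≡ ∑[ i < n ] ⟦ lookup p i ⟧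
∣p∣≡∑ [] = refl
∣p∣≡∑ (true ∷ p) = cong suc (∣p∣≡∑ p)
∣p∣≡∑ (false ∷ p) = ∣p∣≡∑ p

∣p∪q∣≤∣p∣+∣q∣ : ∀ {n} (p q : Subset n) → ∣ p ∪ q ∣ ≤ ∣ p ∣ + ∣ q ∣
∣p∪q∣≤∣p∣+∣q∣ [] [] = z≤n
∣p∪q∣≤∣p∣+∣q∣ (inside ∷ p) (s ∷ q) =
  s≤s (≤-trans (∣p∪q∣≤∣p∣+∣q∣ p q) (+-monoʳ-≤ ∣ p ∣ (∣p∣≤∣x∷p∣ s q)))
∣p∪q∣≤∣p∣+∣q∣ (outside ∷ p) (inside ∷ q) =
  subst (suc ∣ p ∪ q ∣ ≤_) (sym (+-suc ∣ p ∣ ∣ q ∣)) (s≤s (∣p∪q∣≤∣p∣+∣q∣ p q))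
∣p∪q∣≤∣p∣+∣q∣ (outside ∷ p) (outside ∷ q) = ∣p∪q∣≤∣p∣+∣q∣ p q

x∉p⇒∣p∣<∣p∪⁅x⁆∣ : ∀ {n} {p : Subset n} {x} → x ∉ p → ∣ p ∣ < ∣ p ∪ ⁅ x ⁆ ∣
x∉p⇒∣p∣<∣p∪⁅x⁆∣ {p = p} {x} x∉p =
  p⊂q⇒∣p∣<∣q∣ (p⊆p∪q ⁅ x ⁆ , x , q⊆p∪q p ⁅ x ⁆ (x∈⁅x⁆ x) , x∉p)

lookup-injective : ∀ {A : Set} {xs : List A} → Unique xs →
  ∀ {i j} → List.lookup xs i ≡ List.lookup xs j → i ≡ j
lookup-injective (_ ∷ _) {zero} {zero} _ = refl
lookup-injective (x∉xs ∷ _) {zero} {suc j} eq = contradiction eq (All.lookup x∉xs (∈-lookup j))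
lookup-injective (x∉xs ∷ _) {suc i} {zero} eq = contradiction (sym eq) (All.lookup x∉xs (∈-lookup i))
lookup-injective (_ ∷ unique) {suc i} {suc j} eq = cong suc (lookup-injective unique eq)

unique-length≤ : ∀ {n} {xs : List (Fin n)} → Unique xs → length xs ≤ n
unique-length≤ unique = injective⇒≤ (lookup-injective unique)

module _ {n : ℕ} (G : Graph n) where

  adj⇒∈Nbhd : ∀ {v u} → Adj G v u ≡ true → u ∈ Nbhd G v
  adj⇒∈Nbhd {v} {u} vu = lookup⇒[]= u (Nbhd G v) (trans (lookup∘tabulate (Adj G v) u) vu)

  walk-exit : ∀ {S T : Subset n} {u w} → WalkIn G S u w → u ∈ T → w ∉ T →
    ∃[ t ] ∃[ s ] (t ∈ T × s ∉ T × s ∈ S × Adj G t s ≡ true)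
  walk-exit (here _) u∈T u∉T = contradiction u∈T u∉T
  walk-exit {T = T} {u} (step _ uv walk) u∈T w∉T with _ ∈? T
  ... | yes v∈T = walk-exit walk v∈T w∉T
  ... | no v∉T = u , _ , u∈T , v∉T , walk-start walk , uv
    where
    walk-start : ∀ {S v w} → WalkIn G S v w → v ∈ S
    walk-start (here v∈S) = v∈S
    walk-start (step v∈S _ _) = v∈S

  connected-exit : ∀ {S T s} → ConnectedSet G S → s ∈ S → s ∈ T →
    S ⊆ T ⊎ ∃[ t ] ∃[ u ] (t ∈ T × u ∉ T × u ∈ S × Adj G t u ≡ true)
  connected-exit {S} {T} {s} conn s∈S s∈T with any? (λ v → v ∈? S ×-dec ¬? (v ∈? T))
  ... | yes (v , v∈S , v∉T) = inj₂ (walk-exit (conn s v s∈S v∈S) s∈T v∉T)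
  ... | no none = inj₁ S⊆T
    where
    S⊆T : S ⊆ T
    S⊆T {v} v∈S with v ∈? T
    ... | yes v∈T = v∈T
    ... | no v∉T = contradiction (v , v∈S , v∉T) none

  degree≡∑ : ∀ v → degree G v ≡ ∑[ u < n ] ⟦ Adj G v u ⟧
  degree≡∑ v = trans (∣p∣≡∑ (Nbhd G v)) (sum-cong-≗ (cong ⟦_⟧ ∘ lookup∘tabulate (Adj G v)))

  length-endpoints : ∀ M → length (endpoints G M) ≡ 2 * length M
  length-endpoints [] = refl
  length-endpoints (_ ∷ M) =
    cong suc (trans (cong suc (length-endpoints M)) (sym (+-suc (length M) (length M + 0))))

  matching-size≤ : ∀ {M} → IsMatching G M → 2 * length M ≤ n
  matching-size≤ {M} (_ , unique) = subst (_≤ n) (length-endpoints M) (unique-length≤ unique)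

  module _ {R : ℕ} (regular : Regular G (suc R)) where

    ∑adj≡ : ∀ v → ∑[ u < n ] ⟦ Adj G v u ⟧ ≡ suc R
    ∑adj≡ v = trans (sym (degree≡∑ v)) (regular v)

    -- Double counting the edges between the support of ℓ and V.
    ∑weight≤∣V∣ : (ℓ : Fin n → ℕ) (V : Subset n) → (∀ a → ℓ a ≤ 1) →
      (∀ {a b} → 0 < ℓ a → Adj G a b ≡ true → b ∈ V) → sum ℓ ≤ ∣ V ∣
    ∑weight≤∣V∣ ℓ V ℓ≤1 closed = *-cancelˡ-≤ (suc R) (begin
      suc R * sum ℓ
        ≡⟨ *-distribˡ-sum (suc R) ℓ ⟩
      ∑[ a < n ] (suc R * ℓ a)
        ≡⟨ sum-cong-≗ (λ a → trans (cong (ℓ a *_) (∑adj≡ a)) (*-comm (ℓ a) (suc R))) ⟨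
      ∑[ a < n ] (ℓ a * ∑[ b < n ] ⟦ Adj G a b ⟧)
        ≡⟨ sum-cong-≗ (λ a → *-distribˡ-sum (ℓ a) (⟦_⟧ ∘ Adj G a)) ⟩
      ∑[ a < n ] ∑[ b < n ] (ℓ a * ⟦ Adj G a b ⟧)
        ≤⟨ ∑-mono-≤ (λ a → ∑-mono-≤ (edge≤ a)) ⟩
      ∑[ a < n ] ∑[ b < n ] (⟦ lookup V b ⟧ * ⟦ Adj G b a ⟧)
        ≡⟨ ∑-comm (λ a b → ⟦ lookup V b ⟧ * ⟦ Adj G b a ⟧) ⟩
      ∑[ b < n ] ∑[ a < n ] (⟦ lookup V b ⟧ * ⟦ Adj G b a ⟧)
        ≡⟨ sum-cong-≗ (λ b → *-distribˡ-sum ⟦ lookup V b ⟧ (⟦_⟧ ∘ Adj G b)) ⟨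
      ∑[ b < n ] (⟦ lookup V b ⟧ * ∑[ a < n ] ⟦ Adj G b a ⟧)
        ≡⟨ sum-cong-≗ (λ b → trans (cong (⟦ lookup V b ⟧ *_) (∑adj≡ b)) (*-comm _ (suc R))) ⟩
      ∑[ b < n ] (suc R * ⟦ lookup V b ⟧)
        ≡⟨ trans (cong (suc R *_) (∣p∣≡∑ V)) (*-distribˡ-sum (suc R) (⟦_⟧ ∘ lookup V)) ⟨
      suc R * ∣ V ∣ ∎)
      where
      open ≤-Reasoning
      edge≤ : ∀ a b → ℓ a * ⟦ Adj G a b ⟧ ≤ ⟦ lookup V b ⟧ * ⟦ Adj G b a ⟧
      edge≤ a b with ℓ a in ℓa | Adj G a b in ab
      ... | zero | _ = z≤n
      ... | suc k | false = subst (_≤ ⟦ lookup V b ⟧ * ⟦ Adj G b a ⟧) (sym (*-zeroʳ (suc k))) z≤n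
      ... | suc k | true
        rewrite symAdj G b a | ab | []=⇒lookup (closed (subst (0 <_) (sym ℓa) (s≤s z≤n)) ab) =
        subst (_≤ 1) (sym (*-identityʳ (suc k))) (subst (_≤ 1) ℓa (ℓ≤1 a))

-- Closed neighbourhoods of connected dominating sets

module _ {n : ℕ} (G : Graph n) where

  NbhdCoveredBy : Subset n → Subset n → Set
  NbhdCoveredBy T C = ∀ {t} → t ∈ T → t ∈ C × Nbhd G t ⊆ C

  module _ {R : ℕ} (regular : Regular G (suc R)) where

    ClosedNbhdBound : Subset n → Set
    ClosedNbhdBound T = ∃[ C ] (NbhdCoveredBy T C × ∣ C ∣ ≤ R * ∣ T ∣ + 2)

    closedNbhd-⁅⁆ : ∀ s → ClosedNbhdBound ⁅ s ⁆
    closedNbhd-⁅⁆ s = ⁅ s ⁆ ∪ Nbhd G s , covered , bound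
      where
      covered : NbhdCoveredBy ⁅ s ⁆ (⁅ s ⁆ ∪ Nbhd G s)
      covered {t} t∈⁅s⁆ rewrite x∈⁅y⁆⇒x≡y s t∈⁅s⁆ = p⊆p∪q _ (x∈⁅x⁆ s) , q⊆p∪q ⁅ s ⁆ _
      bound : ∣ ⁅ s ⁆ ∪ Nbhd G s ∣ ≤ R * ∣ ⁅ s ⁆ ∣ + 2
      bound = begin
        ∣ ⁅ s ⁆ ∪ Nbhd G s ∣     ≤⟨ ∣p∪q∣≤∣p∣+∣q∣ ⁅ s ⁆ (Nbhd G s) ⟩
        ∣ ⁅ s ⁆ ∣ + degree G s   ≡⟨ cong₂ _+_ (∣⁅x⁆∣≡1 s) (regular s) ⟩
        1 + suc R               ≡⟨ solve 1 (λ r → con 1 :+ (con 1 :+ r) := r :* con 1 :+ con 2) refl R ⟩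
        R * 1 + 2               ≡⟨ cong (λ k → R * k + 2) (∣⁅x⁆∣≡1 s) ⟨
        R * ∣ ⁅ s ⁆ ∣ + 2 ∎
        where open ≤-Reasoning

    -- s and t are already covered, so only the neighbours of s other than t can be new.
    closedNbhd-step : ∀ {T t s} → t ∈ T → Adj G t s ≡ true → s ∉ T →
      ClosedNbhdBound T → ClosedNbhdBound (T ∪ ⁅ s ⁆)
    closedNbhd-step {T} {t} {s} t∈T ts s∉T (C , covered , bound) =
      C ∪ (Nbhd G s - t) , covered′ , bound′
      where
      covered′ : NbhdCoveredBy (T ∪ ⁅ s ⁆) (C ∪ (Nbhd G s - t))
      covered′ {v} v∈ with x∈p∪q⁻ T ⁅ s ⁆ v∈
      ... | inj₁ v∈T = p⊆p∪q _ (proj₁ (covered v∈T)) , λ u∈ → p⊆p∪q _ (proj₂ (covered v∈T) u∈)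
      ... | inj₂ v∈⁅s⁆ rewrite x∈⁅y⁆⇒x≡y s v∈⁅s⁆ =
        p⊆p∪q _ (proj₂ (covered t∈T) (adj⇒∈Nbhd G ts)) , nbr
        where
        nbr : Nbhd G s ⊆ C ∪ (Nbhd G s - t)
        nbr {u} u∈ with u ≟ t
        ... | yes refl = p⊆p∪q _ (proj₁ (covered t∈T))
        ... | no u≢t = q⊆p∪q C _ (x∈p∧x≢y⇒x∈p-y u∈ u≢t)
      new≤R : ∣ Nbhd G s - t ∣ ≤ R
      new≤R = ≤-pred (subst (∣ Nbhd G s - t ∣ <_) (regular s)
                (x∈p⇒∣p-x∣<∣p∣ (adj⇒∈Nbhd G (trans (symAdj G s t) ts))))
      bound′ : ∣ C ∪ (Nbhd G s - t) ∣ ≤ R * ∣ T ∪ ⁅ s ⁆ ∣ + 2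
      bound′ = begin
        ∣ C ∪ (Nbhd G s - t) ∣    ≤⟨ ∣p∪q∣≤∣p∣+∣q∣ C _ ⟩
        ∣ C ∣ + ∣ Nbhd G s - t ∣   ≤⟨ +-mono-≤ bound new≤R ⟩
        R * ∣ T ∣ + 2 + R
          ≡⟨ solve 2 (λ r k → r :* k :+ con 2 :+ r := r :* (con 1 :+ k) :+ con 2) refl R ∣ T ∣ ⟩
        R * suc ∣ T ∣ + 2         ≤⟨ +-monoˡ-≤ 2 (*-monoʳ-≤ R (x∉p⇒∣p∣<∣p∪⁅x⁆∣ s∉T)) ⟩
        R * ∣ T ∪ ⁅ s ⁆ ∣ + 2 ∎
        where open ≤-Reasoning

    closedNbhd-connected : ∀ {S s} → ConnectedSet G S → s ∈ S → ClosedNbhdBound S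
    closedNbhd-connected {S} {s} conn s∈S =
      grow ∣ S ∣ ⁅ s ⁆ ⁅s⁆⊆S (x∈⁅x⁆ s) (m≤n+m ∣ S ∣ ∣ ⁅ s ⁆ ∣) (closedNbhd-⁅⁆ s)
      where
      ⁅s⁆⊆S : ⁅ s ⁆ ⊆ S
      ⁅s⁆⊆S v∈ rewrite x∈⁅y⁆⇒x≡y s v∈ = s∈S
      grow : ∀ d T → T ⊆ S → s ∈ T → ∣ S ∣ ≤ ∣ T ∣ + d → ClosedNbhdBound T → ClosedNbhdBound S
      grow d T T⊆S s∈T fuel bound with connected-exit G conn s∈S s∈T
      ... | inj₁ S⊆T = subst ClosedNbhdBound (⊆-antisym T⊆S S⊆T) bound
      ... | inj₂ (t , u , t∈T , u∉T , u∈S , tu) = grow′ d fuel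
        where
        T′⊆S : T ∪ ⁅ u ⁆ ⊆ S
        T′⊆S v∈ with x∈p∪q⁻ T ⁅ u ⁆ v∈
        ... | inj₁ v∈T = T⊆S v∈T
        ... | inj₂ v∈⁅u⁆ rewrite x∈⁅y⁆⇒x≡y u v∈⁅u⁆ = u∈S
        grown : suc ∣ T ∣ ≤ ∣ S ∣
        grown = ≤-trans (x∉p⇒∣p∣<∣p∪⁅x⁆∣ u∉T) (p⊆q⇒∣p∣≤∣q∣ T′⊆S)
        grow′ : ∀ d → ∣ S ∣ ≤ ∣ T ∣ + d → ClosedNbhdBound S
        grow′ zero fuel′ = contradiction (subst (∣ S ∣ ≤_) (+-identityʳ ∣ T ∣) fuel′) (<⇒≱ grown)
        grow′ (suc d′) fuel′ = grow d′ (T ∪ ⁅ u ⁆) T′⊆S (p⊆p∪q _ s∈T)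
          (≤-trans fuel′ (≤-trans (≤-reflexive (+-suc ∣ T ∣ d′))
                                   (+-monoˡ-≤ d′ (x∉p⇒∣p∣<∣p∪⁅x⁆∣ u∉T))))
          (closedNbhd-step t∈T tu u∉T bound)

order≤connDom : ∀ {n} (G : Graph n) {R} → Regular G (suc R) →
  ∀ {S} → ConnDominating G S → n ≤ R * ∣ S ∣ + 2
order≤connDom {zero} _ _ _ = z≤n
order≤connDom {suc n} G {R} regular {S} (dominating , conn) =
  let (C , covered , bound) = closedNbhd-connected G regular conn (proj₂ member)
  in begin
    suc n           ≡⟨ ∣⊤∣≡n (suc n) ⟨
    ∣ ⊤ {suc n} ∣    ≤⟨ p⊆q⇒∣p∣≤∣q∣ (⊤⊆ covered) ⟩
    ∣ C ∣            ≤⟨ bound ⟩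
    R * ∣ S ∣ + 2    ∎
  where
  open ≤-Reasoning
  member : ∃[ s ] s ∈ S
  member with zero ∈? S
  ... | yes 0∈S = zero , 0∈S
  ... | no 0∉S = let (u , u∈S , _) = dominating zero 0∉S in u , u∈S
  ⊤⊆ : ∀ {C} → NbhdCoveredBy G S C → ⊤ ⊆ C
  ⊤⊆ covered {v} _ with v ∈? S
  ... | yes v∈S = proj₁ (covered v∈S)
  ... | no v∉S = let (u , u∈S , uv) = dominating v v∉S in proj₂ (covered u∈S) (adj⇒∈Nbhd G uv)

-- Matching an independent set into its complement

Mate : ℕ → Set
Mate n = Fin n → Maybe (Fin n)

_[_≔_] : ∀ {n} → Mate n → Fin n → Maybe (Fin n) → Mate n
m [ b ≔ v ] = updateAt m b (const v)

≔-cases : ∀ {n} (m : Mate n) b v {c w} → (m [ b ≔ v ]) c ≡ w → (c ≡ b × v ≡ w) ⊎ (c ≢ b × m c ≡ w)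
≔-cases m b v {c} eq with c ≟ b
... | yes refl = inj₁ (refl , trans (sym (updateAt-updates b m)) eq)
... | no c≢b = inj₂ (c≢b , trans (sym (updateAt-minimal c b m c≢b)) eq)

module Augmenting {n : ℕ} (G : Graph n) (I : Subset n) (independent : Independent G I) where

  -- m b ≡ just a records the matching edge ab, whose endpoint a lies in I.
  record Valid (m : Mate n) : Set where
    field
      mate∈I : ∀ {a b} → m b ≡ just a → a ∈ I
      mate-adj : ∀ {a b} → m b ≡ just a → Adj G a b ≡ true
      mate-injective : ∀ {a b b′} → m b ≡ just a → m b′ ≡ just a → b ≡ b′
  open Valid

  Covered : Mate n → Fin n → Set
  Covered m a = ∃[ b ] m b ≡ just a

  size : Mate n → ℕ
  size m = ∑[ b < n ] ⟦ is-just (m b) ⟧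

  rematch-valid : ∀ {m x b} → Valid m → x ∈ I → ¬ Covered m x → Adj G x b ≡ true →
    Valid (m [ b ≔ just x ])
  rematch-valid {m} {x} {b} valid x∈I x∉m xb = record
    { mate∈I = in-I ; mate-adj = adjacent ; mate-injective = injective }
    where
    in-I : ∀ {a c} → (m [ b ≔ just x ]) c ≡ just a → a ∈ I
    in-I eq with ≔-cases m b _ eq
    ... | inj₁ (_ , refl) = x∈I
    ... | inj₂ (_ , eq′) = mate∈I valid eq′
    adjacent : ∀ {a c} → (m [ b ≔ just x ]) c ≡ just a → Adj G a c ≡ true
    adjacent eq with ≔-cases m b _ eq
    ... | inj₁ (refl , refl) = xb
    ... | inj₂ (_ , eq′) = mate-adj valid eq′
    injective : ∀ {a c c′} → (m [ b ≔ just x ]) c ≡ just a → (m [ b ≔ just x ]) c′ ≡ just a → c ≡ c′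
    injective eq eq′ with ≔-cases m b _ eq | ≔-cases m b _ eq′
    ... | inj₁ (refl , _) | inj₁ (refl , _) = refl
    ... | inj₁ (_ , refl) | inj₂ (_ , eq″) = contradiction (_ , eq″) x∉m
    ... | inj₂ (_ , eq″) | inj₁ (_ , refl) = contradiction (_ , eq″) x∉m
    ... | inj₂ (_ , eq″) | inj₂ (_ , eq‴) = mate-injective valid eq″ eq‴

  rematch-covered : ∀ {m x b a} → Covered (m [ b ≔ just x ]) a → Covered m a ⊎ a ≡ x
  rematch-covered {m} {x} {b} (c , eq) with ≔-cases m b _ eq
  ... | inj₁ (_ , refl) = inj₂ refl
  ... | inj₂ (_ , eq′) = inj₁ (c , eq′)

  clear-entry : ∀ (m : Mate n) b {c a} → (m [ b ≔ nothing ]) c ≡ just a → c ≢ b × m c ≡ just a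
  clear-entry m b eq with ≔-cases m b nothing eq
  ... | inj₁ (_ , ())
  ... | inj₂ entry = entry

  clear-valid : ∀ {m b} → Valid m → Valid (m [ b ≔ nothing ])
  clear-valid {m} {b} valid = record
    { mate∈I = mate∈I valid ∘ entry
    ; mate-adj = mate-adj valid ∘ entry
    ; mate-injective = λ eq eq′ → mate-injective valid (entry eq) (entry eq′) }
    where
    entry : ∀ {c a} → (m [ b ≔ nothing ]) c ≡ just a → m c ≡ just a
    entry = proj₂ ∘ clear-entry m b

  -- The result of augmenting along a path from x whose free end lies outside V.
  record Augmentation (m : Mate n) (x : Fin n) (V : Subset n) : Set where
    field
      mate′ : Mate n
      end : Fin n
      end∉V : end ∉ V
      end-free : m end ≡ nothing
      end-matched : is-just (mate′ end) ≡ true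
      unchanged : ∀ {b} → b ≢ end → is-just (mate′ b) ≡ is-just (m b)
      valid′ : Valid mate′
      covered′ : ∀ {a} → Covered mate′ a → Covered m a ⊎ a ≡ x

  -- The outcome of a failed search from x through the neighbours bs: every vertex added to the
  -- visited set V is matched to a vertex whose neighbourhood was visited as well.
  record Obstruction (m : Mate n) (x : Fin n) (V : Subset n) (bs : List (Fin n)) : Set where
    field
      V′ : Subset n
      V⊆V′ : V ⊆ V′
      nbrs∈V′ : ∀ {b} → b ∈ˡ bs → Adj G x b ≡ true → b ∈ V′
      closed : ∀ {b} → b ∈ V′ → b ∉ V → ∃[ a ] (m b ≡ just a × (∀ {c} → Adj G a c ≡ true → c ∈ V′))

  augment-free : ∀ {m x V b} → Valid m → x ∈ I → ¬ Covered m x → Adj G x b ≡ true →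
    b ∉ V → m b ≡ nothing → Augmentation m x V
  augment-free {m} {x} {V} {b} valid x∈I x∉m xb b∉V b-free = record
    { mate′ = m [ b ≔ just x ]
    ; end = b
    ; end∉V = b∉V
    ; end-free = b-free
    ; end-matched = cong is-just (updateAt-updates b m)
    ; unchanged = λ c≢b → cong is-just (updateAt-minimal _ b m c≢b)
    ; valid′ = rematch-valid valid x∈I x∉m xb
    ; covered′ = rematch-covered }

  augment-via : ∀ {m x V b a} → Valid m → x ∈ I → ¬ Covered m x → Adj G x b ≡ true →
    b ∉ V → m b ≡ just a → Augmentation (m [ b ≔ nothing ]) a (V ∪ ⁅ b ⁆) → Augmentation m x V
  augment-via {m} {x} {V} {b} {a} valid x∈I x∉m xb b∉V ba A = record
    { mate′ = A.mate′ [ b ≔ just x ]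
    ; end = A.end
    ; end∉V = A.end∉V ∘ p⊆p∪q ⁅ b ⁆
    ; end-free = trans (sym (updateAt-minimal A.end b m end≢b)) A.end-free
    ; end-matched = trans (cong is-just (updateAt-minimal A.end b A.mate′ end≢b)) A.end-matched
    ; unchanged = unchanged
    ; valid′ = rematch-valid A.valid′ x∈I x∉mate′ xb
    ; covered′ = covered }
    where
    module A = Augmentation A
    end≢b : A.end ≢ b
    end≢b refl = A.end∉V (q⊆p∪q V ⁅ b ⁆ (x∈⁅x⁆ b))
    covered-before : ∀ {y} → Covered A.mate′ y → Covered m y
    covered-before cov with A.covered′ cov
    ... | inj₁ (c , eq) = c , proj₂ (clear-entry m b eq)
    ... | inj₂ refl = b , ba
    x∉mate′ : ¬ Covered A.mate′ x
    x∉mate′ = x∉m ∘ covered-before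
    unchanged : ∀ {c} → c ≢ A.end → is-just ((A.mate′ [ b ≔ just x ]) c) ≡ is-just (m c)
    unchanged {c} c≢end with c ≟ b
    ... | yes refl = trans (cong is-just (updateAt-updates b A.mate′)) (cong is-just (sym ba))
    ... | no c≢b = begin
      is-just ((A.mate′ [ b ≔ just x ]) c) ≡⟨ cong is-just (updateAt-minimal c b A.mate′ c≢b) ⟩
      is-just (A.mate′ c)                  ≡⟨ A.unchanged c≢end ⟩
      is-just ((m [ b ≔ nothing ]) c)      ≡⟨ cong is-just (updateAt-minimal c b m c≢b) ⟩
      is-just (m c)                        ∎
      where open ≡-Reasoning
    covered : ∀ {y} → Covered (A.mate′ [ b ≔ just x ]) y → Covered m y ⊎ y ≡ x
    covered cov with rematch-covered cov
    ... | inj₁ cov′ = inj₁ (covered-before cov′)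
    ... | inj₂ y≡x = inj₂ y≡x

  shrink-avoided : ∀ {m x V W} → V ⊆ W → Augmentation m x W → Augmentation m x V
  shrink-avoided V⊆W A = record
    { mate′ = mate′ ; end = end ; end∉V = end∉V ∘ V⊆W ; end-free = end-free
    ; end-matched = end-matched ; unchanged = unchanged ; valid′ = valid′ ; covered′ = covered′ }
    where open Augmentation A

  obstruction-[] : ∀ {m x V} → Obstruction m x V []
  obstruction-[] {V = V} = record
    { V′ = V ; V⊆V′ = λ b∈V → b∈V ; nbrs∈V′ = λ () ; closed = λ b∈V b∉V → contradiction b∈V b∉V }

  obstruction-full : ∀ {m x V} → n ≤ ∣ V ∣ → Obstruction m x V (allFin n)
  obstruction-full {V = V} full = record
    { V′ = V ; V⊆V′ = λ b∈V → b∈V ; nbrs∈V′ = λ _ _ → everything∈V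
    ; closed = λ b∈V b∉V → contradiction b∈V b∉V }
    where
    everything∈V : ∀ {b} → b ∈ V
    everything∈V {b} = subst (b ∈_) (sym (∣p∣≡n⇒p≡⊤ (≤-antisym (∣p∣≤n V) full))) ∈⊤

  obstruction-∷ : ∀ {m x V b bs} (O : Obstruction m x V bs) →
    (Adj G x b ≡ true → b ∈ Obstruction.V′ O) → Obstruction m x V (b ∷ bs)
  obstruction-∷ O b∈V′ = record
    { V′ = V′ ; V⊆V′ = V⊆V′ ; closed = closed
    ; nbrs∈V′ = λ { (here refl) → b∈V′ ; (there b∈bs) → nbrs∈V′ b∈bs } }
    where open Obstruction O

  obstruction-via : ∀ {m x V b a bs} → b ∉ V → m b ≡ just a →
    (O : Obstruction (m [ b ≔ nothing ]) a (V ∪ ⁅ b ⁆) (allFin n)) →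
    Obstruction m x (Obstruction.V′ O) bs → Obstruction m x V (b ∷ bs)
  obstruction-via {m} {x} {V} {b} {a} b∉V ba O O′ = record
    { V′ = O′.V′
    ; V⊆V′ = O′.V⊆V′ ∘ O.V⊆V′ ∘ p⊆p∪q ⁅ b ⁆
    ; nbrs∈V′ = λ { (here refl) _ → O′.V⊆V′ (O.V⊆V′ (q⊆p∪q V ⁅ b ⁆ (x∈⁅x⁆ b)))
                  ; (there c∈bs) → O′.nbrs∈V′ c∈bs }
    ; closed = closed }
    where
    module O = Obstruction O
    module O′ = Obstruction O′
    closed : ∀ {c} → c ∈ O′.V′ → c ∉ V →
      ∃[ a′ ] (m c ≡ just a′ × (∀ {d} → Adj G a′ d ≡ true → d ∈ O′.V′))
    closed {c} c∈V′ c∉V with c ∈? O.V′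
    ... | no c∉O = O′.closed c∈V′ c∉O
    ... | yes c∈O with c ≟ b
    ...   | yes refl = a , ba , λ ad → O′.V⊆V′ (O.nbrs∈V′ (∈-allFin _) ad)
    ...   | no c≢b =
      let (a′ , ca′ , nbrs) = O.closed c∈O c∉V∪b
      in a′ , proj₂ (clear-entry m b ca′) , O′.V⊆V′ ∘ nbrs
      where
      c∉V∪b : c ∉ V ∪ ⁅ b ⁆
      c∉V∪b c∈ with x∈p∪q⁻ V ⁅ b ⁆ c∈
      ... | inj₁ c∈V = c∉V c∈V
      ... | inj₂ c∈⁅b⁆ = c≢b (x∈⁅y⁆⇒x≡y b c∈⁅b⁆)

  -- Depth-first search; each recursive call visits a new vertex, so n - |V| bounds its depth.
  mutual
    search : ∀ fuel {m x V} → Valid m → x ∈ I → ¬ Covered m x → n ≤ ∣ V ∣ + fuel →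
      Augmentation m x V ⊎ Obstruction m x V (allFin n)
    search zero _ _ _ full = inj₂ (obstruction-full (subst (n ≤_) (+-identityʳ _) full))
    search (suc fuel) valid x∈I x∉m bound = scan fuel valid x∈I x∉m bound (allFin n)

    scan : ∀ fuel {m x V} → Valid m → x ∈ I → ¬ Covered m x → n ≤ ∣ V ∣ + suc fuel →
      (bs : List (Fin n)) → Augmentation m x V ⊎ Obstruction m x V bs
    scan fuel valid x∈I x∉m bound [] = inj₂ obstruction-[]
    scan fuel {m} {x} {V} valid x∈I x∉m bound (b ∷ bs) with Adj G x b in xb | b ∈? V | m b in mb
    ... | false | _ | _ =
      Sum.map₂ (λ O → obstruction-∷ O (λ xb′ → contradiction (trans (sym xb′) xb) λ ()))
               (scan fuel valid x∈I x∉m bound bs)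
    ... | true | yes b∈V | _ = Sum.map₂ (λ O → obstruction-∷ O (λ _ → Obstruction.V⊆V′ O b∈V))
                                       (scan fuel valid x∈I x∉m bound bs)
    ... | true | no b∉V | nothing = inj₁ (augment-free valid x∈I x∉m xb b∉V mb)
    ... | true | no b∉V | just a with search fuel (clear-valid valid) (mate∈I valid mb) a∉m′ bound′
      where
      a∉m′ : ¬ Covered (m [ b ≔ nothing ]) a
      a∉m′ (c , ca) = let (c≢b , ca′) = clear-entry m b ca in c≢b (mate-injective valid ca′ mb)
      bound′ : n ≤ ∣ V ∪ ⁅ b ⁆ ∣ + fuel
      bound′ = ≤-trans bound (≤-trans (≤-reflexive (+-suc ∣ V ∣ fuel))
                                      (+-monoˡ-≤ fuel (x∉p⇒∣p∣<∣p∪⁅x⁆∣ b∉V)))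
    ... | inj₁ A = inj₁ (augment-via valid x∈I x∉m xb b∉V mb A)
    ... | inj₂ O with scan fuel valid x∈I x∉m bound″ bs
      where
      bound″ : n ≤ ∣ Obstruction.V′ O ∣ + suc fuel
      bound″ = ≤-trans bound (+-monoˡ-≤ (suc fuel) (p⊆q⇒∣p∣≤∣q∣ (Obstruction.V⊆V′ O ∘ p⊆p∪q ⁅ b ⁆)))
    ...   | inj₁ A = inj₁ (shrink-avoided (Obstruction.V⊆V′ O ∘ p⊆p∪q ⁅ b ⁆) A)
    ...   | inj₂ O′ = inj₂ (obstruction-via b∉V mb O O′)

  isMate : Mate n → Fin n → Fin n → ℕ
  isMate m b a = ⟦ does (Maybe.≡-dec _≟_ (m b) (just a)) ⟧

  isMate≡1 : ∀ {m b a} → m b ≡ just a → isMate m b a ≡ 1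
  isMate≡1 {a = a} eq rewrite eq | dec-true (a ≟ a) refl = refl

  isMate-positive : ∀ {m b a} → 0 < isMate m b a → m b ≡ just a
  isMate-positive {m} {b} {a} p with Maybe.≡-dec _≟_ (m b) (just a)
  ... | yes eq = eq

  ∑-isMate : ∀ m b → ∑[ a < n ] isMate m b a ≡ ⟦ is-just (m b) ⟧
  ∑-isMate m b with m b
  ... | just a′ = ∑-δ a′
  ... | nothing = sum-replicate-zero n

  uncovered-vertex : ∀ {m} → size m < ∣ I ∣ → ∃[ x ] (x ∈ I × ¬ Covered m x)
  uncovered-vertex {m} size<∣I∣ with ∑<∑⇒< coverCount (⟦_⟧ ∘ lookup I) (begin-strict
      sum coverCount                          ≡⟨ ∑-comm (λ a b → isMate m b a) ⟩
      ∑[ b < n ] ∑[ a < n ] isMate m b a     ≡⟨ sum-cong-≗ (∑-isMate m) ⟩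
      size m                                 <⟨ size<∣I∣ ⟩
      ∣ I ∣                                   ≡⟨ ∣p∣≡∑ I ⟩
      ∑[ a < n ] ⟦ lookup I a ⟧              ∎)
    where
    open ≤-Reasoning
    coverCount : Fin n → ℕ
    coverCount a = ∑[ b < n ] isMate m b a
  ... | x , count<⟦x∈I⟧ with lookup I x in x∈I
  ... | true = x , lookup⇒[]= x I x∈I , λ (b , bx) →
          <⇒≱ count<⟦x∈I⟧ (≤-trans (≤-reflexive (sym (isMate≡1 {m} {b} bx)))
                                   (∑-≥ (λ c → isMate m c x) b))

  matesIn : Subset n → Mate n → Fin n → ℕ
  matesIn V m a = ∑[ b < n ] (⟦ lookup V b ⟧ * isMate m b a)

  matesIn-term : ∀ V m a b → 0 < ⟦ lookup V b ⟧ * isMate m b a → b ∈ V × m b ≡ just a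
  matesIn-term V m a b p with lookup V b in b∈V
  ... | true = lookup⇒[]= b V b∈V , isMate-positive {m} {b} (subst (0 <_) (+-identityʳ _) p)

  matesIn-positive : ∀ V m {a} → 0 < matesIn V m a → ∃[ b ] (b ∈ V × m b ≡ just a)
  matesIn-positive V m {a} p = let (b , q) = ∑-positive _ p in b , matesIn-term V m a b q

  matesIn≤1 : ∀ V {m} → Valid m → ∀ a → matesIn V m a ≤ 1
  matesIn≤1 V {m} valid a =
    ∑≤1 _ (λ b → *-mono-≤ (⟦⟧≤1 (lookup V b)) (⟦⟧≤1 _))
      (λ {b} {b′} p q → mate-injective valid (proj₂ (matesIn-term V m a b p))
                                             (proj₂ (matesIn-term V m a b′ q)))

  ∑matesIn : ∀ V m → (∀ {b} → b ∈ V → ∃[ a ] m b ≡ just a) → sum (matesIn V m) ≡ ∣ V ∣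
  ∑matesIn V m matched = begin
    sum (matesIn V m)
      ≡⟨ ∑-comm (λ a b → ⟦ lookup V b ⟧ * isMate m b a) ⟩
    ∑[ b < n ] ∑[ a < n ] (⟦ lookup V b ⟧ * isMate m b a)
      ≡⟨ sum-cong-≗ (λ b → *-distribˡ-sum ⟦ lookup V b ⟧ (isMate m b)) ⟨
    ∑[ b < n ] (⟦ lookup V b ⟧ * ∑[ a < n ] isMate m b a)
      ≡⟨ sum-cong-≗ (λ b → cong (⟦ lookup V b ⟧ *_) (∑-isMate m b)) ⟩
    ∑[ b < n ] (⟦ lookup V b ⟧ * ⟦ is-just (m b) ⟧)
      ≡⟨ sum-cong-≗ in-V-matched ⟩
    ∑[ b < n ] ⟦ lookup V b ⟧
      ≡⟨ ∣p∣≡∑ V ⟨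
    ∣ V ∣ ∎
    where
    open ≡-Reasoning
    in-V-matched : ∀ b → ⟦ lookup V b ⟧ * ⟦ is-just (m b) ⟧ ≡ ⟦ lookup V b ⟧
    in-V-matched b with lookup V b in b∈V
    ... | false = refl
    ... | true rewrite proj₂ (matched (lookup⇒[]= b V b∈V)) = refl

  size-augmented : ∀ {m x V} (A : Augmentation m x V) → size (Augmentation.mate′ A) ≡ suc (size m)
  size-augmented {m} A = begin
    size mate′                               ≡⟨ sum-cong-≗ size-pointwise ⟩
    ∑[ b < n ] (⟦ is-just (m b) ⟧ + δ end b)  ≡⟨ ∑-distrib-+ (⟦_⟧ ∘ is-just ∘ m) (δ end) ⟩
    size m + ∑[ b < n ] δ end b              ≡⟨ cong (size m +_) (∑-δ end) ⟩
    size m + 1                               ≡⟨ +-comm (size m) 1 ⟩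
    suc (size m)                             ∎
    where
    open ≡-Reasoning
    open Augmentation A
    size-pointwise : ∀ b → ⟦ is-just (mate′ b) ⟧ ≡ ⟦ is-just (m b) ⟧ + δ end b
    size-pointwise b with end ≟ b
    ... | yes refl rewrite end-matched | end-free = refl
    ... | no end≢b rewrite unchanged (end≢b ∘ sym) = sym (+-identityʳ _)

  module _ {R : ℕ} (regular : Regular G (suc R)) where

    -- x and the mates of V′ are |V′| + 1 vertices whose neighbours all lie in V′.
    obstruction-impossible : ∀ {m x} → Valid m → ¬ Covered m x → ¬ Obstruction m x ⊥ (allFin n)
    obstruction-impossible {m} {x} valid x∉m O =
      <-irrefl refl (subst (_≤ ∣ V′ ∣) ∑ℓ≡ (∑weight≤∣V∣ G regular ℓ V′ ℓ≤1 ℓ-closed))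
      where
      open Obstruction O
      ℓ : Fin n → ℕ
      ℓ a = δ x a + matesIn V′ m a
      ℓ≤1 : ∀ a → ℓ a ≤ 1
      ℓ≤1 a with x ≟ a
      ... | no _ = matesIn≤1 V′ valid a
      ... | yes refl with matesIn V′ m x in mates
      ...   | zero = ≤-refl
      ...   | suc _ = let (b , _ , bx) = matesIn-positive V′ m (subst (0 <_) (sym mates) (s≤s z≤n))
                      in contradiction (b , bx) x∉m
      ℓ-closed : ∀ {a c} → 0 < ℓ a → Adj G a c ≡ true → c ∈ V′
      ℓ-closed {a} p ac with x ≟ a
      ... | yes refl = nbrs∈V′ (∈-allFin _) ac
      ... | no _ = let (b , b∈V′ , ba) = matesIn-positive V′ m p
                       (a′ , ba′ , nbrs) = closed b∈V′ ∉⊥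
                       a′≡a = Maybe.just-injective (trans (sym ba′) ba)
                   in nbrs (subst (λ y → Adj G y _ ≡ true) (sym a′≡a) ac)
      ∑ℓ≡ : sum ℓ ≡ suc ∣ V′ ∣
      ∑ℓ≡ = trans (∑-distrib-+ (δ x) (matesIn V′ m)) (cong₂ _+_ (∑-δ x) (∑matesIn V′ m matched))
        where
        matched : ∀ {b} → b ∈ V′ → ∃[ a ] m b ≡ just a
        matched b∈V′ = let (a , ba , _) = closed b∈V′ ∉⊥ in a , ba

    augment : ∀ {m x} → Valid m → x ∈ I → ¬ Covered m x →
      ∃[ m′ ] (Valid m′ × size m′ ≡ suc (size m))
    augment valid x∈I x∉m with search n valid x∈I x∉m (m≤n+m n ∣ ⊥ {n} ∣)
    ... | inj₂ O = contradiction O (obstruction-impossible valid x∉m)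
    ... | inj₁ A = Augmentation.mate′ A , Augmentation.valid′ A , size-augmented A

    matching-of-size : ∀ k → k ≤ ∣ I ∣ → ∃[ m ] (Valid m × size m ≡ k)
    matching-of-size zero _ = const nothing , empty-valid , sum-replicate-zero n
      where
      empty-valid : Valid (const nothing)
      empty-valid = record { mate∈I = λ () ; mate-adj = λ () ; mate-injective = λ () }
    matching-of-size (suc k) k<∣I∣ =
      let (m , valid , size≡k) = matching-of-size k (<⇒≤ k<∣I∣)
          (x , x∈I , x∉m) = uncovered-vertex (subst (_< ∣ I ∣) (sym size≡k) k<∣I∣)
          (m′ , valid′ , size′) = augment valid x∈I x∉m
      in m′ , valid′ , trans size′ (cong suc size≡k)

  matchedEdges : Mate n → List (Fin n) → List (Fin n × Fin n)
  matchedEdges m [] = []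
  matchedEdges m (b ∷ bs) with m b
  ... | just a = (a , b) ∷ matchedEdges m bs
  ... | nothing = matchedEdges m bs

  length-matchedEdges : ∀ m {k} (g : Fin k → Fin n) →
    length (matchedEdges m (List.tabulate g)) ≡ ∑[ i < k ] ⟦ is-just (m (g i)) ⟧
  length-matchedEdges m {zero} g = refl
  length-matchedEdges m {suc k} g with m (g zero)
  ... | just _ = cong suc (length-matchedEdges m (g ∘ suc))
  ... | nothing = length-matchedEdges m (g ∘ suc)

  matchedEdges-adjacent : ∀ {m} → Valid m → ∀ bs →
    All (λ { (u , v) → Adj G u v ≡ true }) (matchedEdges m bs)
  matchedEdges-adjacent valid [] = []
  matchedEdges-adjacent {m} valid (b ∷ bs) with m b in ba
  ... | just a = mate-adj valid ba ∷ matchedEdges-adjacent valid bs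
  ... | nothing = matchedEdges-adjacent valid bs

  ∈-endpoints : ∀ m bs {v} → v ∈ˡ endpoints G (matchedEdges m bs) →
    ∃[ b ] (b ∈ˡ bs × (m b ≡ just v ⊎ (v ≡ b × ∃[ a ] m b ≡ just a)))
  ∈-endpoints m (b ∷ bs) v∈ with m b in ba | v∈
  ... | just a | here refl = b , here refl , inj₁ ba
  ... | just a | there (here refl) = b , here refl , inj₂ (refl , a , ba)
  ... | just a | there (there v∈′) = let (c , c∈bs , cases) = ∈-endpoints m bs v∈′ in c , there c∈bs , cases
  ... | nothing | v∈′ = let (c , c∈bs , cases) = ∈-endpoints m bs v∈′ in c , there c∈bs , cases

  matched∉I : ∀ {m a b} → Valid m → m b ≡ just a → b ∉ I
  matched∉I valid ba b∈I =
    contradiction (trans (sym (mate-adj valid ba)) (independent _ _ (mate∈I valid ba) b∈I)) λ ()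

  unique-endpoints : ∀ {m} → Valid m → ∀ {bs} → Unique bs → Unique (endpoints G (matchedEdges m bs))
  unique-endpoints valid [] = []
  unique-endpoints {m} valid {b ∷ bs} (b∉bs ∷ unique) with m b in ba
  ... | nothing = unique-endpoints valid unique
  ... | just a = (a≢b ∷ All.tabulate a≢) ∷ (All.tabulate b≢ ∷ unique-endpoints valid unique)
    where
    a≢b : a ≢ b
    a≢b refl = contradiction (trans (sym (mate-adj valid ba)) (irrefl G a)) λ ()
    a≢ : ∀ {v} → v ∈ˡ endpoints G (matchedEdges m bs) → a ≢ v
    a≢ v∈ refl with ∈-endpoints m bs v∈
    ... | c , c∈bs , inj₁ ca = All.lookup b∉bs c∈bs (mate-injective valid ba ca)
    ... | c , c∈bs , inj₂ (refl , _ , ca′) = matched∉I valid ca′ (mate∈I valid ba)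
    b≢ : ∀ {v} → v ∈ˡ endpoints G (matchedEdges m bs) → b ≢ v
    b≢ v∈ refl with ∈-endpoints m bs v∈
    ... | c , c∈bs , inj₁ cb = matched∉I valid ba (mate∈I valid cb)
    ... | c , c∈bs , inj₂ (refl , _) = All.lookup b∉bs c∈bs refl

  matching-of-mate : ∀ {m} → Valid m →
    IsMatching G (matchedEdges m (allFin n)) × length (matchedEdges m (allFin n)) ≡ size m
  matching-of-mate {m} valid =
    (matchedEdges-adjacent valid (allFin n) , unique-endpoints valid (allFin⁺ n)) ,
    length-matchedEdges m id

α≤μ : ∀ {n} (G : Graph n) {R} → Regular G (suc R) →
  ∀ {α μ} → IsIndepNumber G α → IsMatchingNumber G μ → α ≤ μ
α≤μ G regular ((I , independent , ∣I∣≡α) , _) (_ , maximum) =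
  let open Augmenting G I independent
      (m , valid , size≡∣I∣) = matching-of-size regular ∣ I ∣ ≤-refl
      (matching , length≡size) = matching-of-mate valid
  in subst (_≤ _) (trans length≡size (trans size≡∣I∣ ∣I∣≡α)) (maximum _ matching)

corollary5 : ∀ (r : ℕ) → 2 ≤ r → ∀ {n : ℕ} (G : Graph n) → Connected G → Regular G r →
    ∀ (γc μ α : ℕ) → IsConnDomNumber G γc → IsMatchingNumber G μ → IsIndepNumber G α →
    (2 * μ ≤ (r ∸ 1) * γc + 2) × (2 * α ≤ 2 * μ)
corollary5 zero ()
corollary5 (suc R) _ G _ regular γc μ α
  ((S , connDom , ∣S∣≡γc) , _) μ-number@((M , matching , ∣M∣≡μ) , _) α-number =
  ≤-trans (subst (λ k → 2 * k ≤ _) ∣M∣≡μ (matching-size≤ G matching))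
          (subst (λ k → _ ≤ R * k + 2) ∣S∣≡γc (order≤connDom G regular connDom)) ,
  *-monoʳ-≤ 2 (α≤μ G regular α-number μ-number)
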